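{- Let $\mathcal{N}=\mathbb{N}^{\mathbb{N}}$ be the Baire space and $X=\{\alpha\in\mathcal{N}:\alpha(0)>0\}$. Let $E\subseteq X\times X$ be symmetric. Then $E$ is analytic ($\boldsymbol{\Sigma}^1_1$) if and only if there is a closed set $F\subseteq X\times X\times X$ which is invariant under the transposition $\tau(\alpha,\beta,\gamma)=(\beta,\alpha,\gamma)$ (i.e. $\tau(F)=F$) and satisfies: for all $\alpha,\beta\in X$, $(\alpha,\beta)\in E\iff \exists\gamma\,(\alpha,\beta,\gamma)\in F$.
   Context: $\mathcal{N}$ carries the product topology of discrete spaces; $X$ is clopen in $\mathcal{N}$, and closedness of subsets of $X^3$ may be taken in $X^3$ or equivalently in $\mathcal{N}^3$. -}

module Defs where

open import Data.Nat using (ℕ; _<_)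
open import Data.Product using (Σ; ∃; _×_)
open import Relation.Binary.PropositionalEquality using (_≡_)
open import Relation.Nullary using (¬_)
open import Function.Bundles using (_⇔_)

Baire : Set
Baire = ℕ → ℕ

InX : Baire → Set
InX α = 0 < α 0

Agree : ℕ → Baire → Baire → Set
Agree n α β = ∀ i → i < n → α i ≡ β i

Rel2 : Set₁
Rel2 = Baire → Baire → Set

Rel3 : Set₁
Rel3 = Baire → Baire → Baire → Set

-- F ⊆ 𝒩³ is closed in the product topology: its complement is open,
-- i.e. every point outside F has a basic neighbourhood disjoint from F.
Closed3 : Rel3 → Set
Closed3 F = ∀ α β γ → ¬ F α β γ →
  ∃ λ n → ∀ α' β' γ' → Agree n α α' → Agree n β β' → Agree n γ γ' → ¬ F α' β' γ'

Analytic2 : Rel2 → Set₁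
Analytic2 E = Σ Rel3 λ C → Closed3 C × (∀ α β → (E α β ⇔ ∃ λ γ → C α β γ))

module Submission where

-- (⇐) is immediate: F itself is a closed set projecting onto E, because
--     E ⊆ X² makes the restriction α, β ∈ X harmless.
-- (⇒) Let C be closed with E = ∃γ. C(α,β,γ). Symmetrise C and move its
--     witness into X by prepending a positive coordinate:
--        F(α,β,γ) := α,β,γ ∈ X  ∧  (C(α,β,tail γ) ∨ C(β,α,tail γ)).
--     F is τ-invariant by construction, projects onto E because E is
--     symmetric, and its witnesses 1∷δ lie in X.

open import Data.Product using (Σ; ∃; _×_; _,_)
open import Data.Sum using (_⊎_; inj₁; inj₂; swap)
open import Data.Nat using (zero; suc; _<_; _≤_; _⊔_; s≤s; z≤n; _<?_)
open import Data.Nat.Properties using (<-≤-trans; n≤1+n; m≤m⊔n; m≤n⊔m)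
open import Relation.Binary.PropositionalEquality using (sym; subst)
open import Relation.Nullary using (¬_; yes; no)
open import Function.Bundles using (_⇔_; mk⇔; Equivalence)
open import Defs

agree-≤ : ∀ {m n α β} → n ≤ m → Agree m α β → Agree n α β
agree-≤ n≤m ag i i<n = ag i (<-≤-trans i<n n≤m)

tail : Baire → Baire
tail γ i = γ (suc i)

agree-tail : ∀ {n γ γ'} → Agree (suc n) γ γ' → Agree n (tail γ) (tail γ')
agree-tail ag i i<n = ag (suc i) (s≤s i<n)

notX-open : ∀ {α α'} → ¬ InX α → Agree 1 α α' → ¬ InX α'
notX-open α∉X ag α'∈X = α∉X (subst (0 <_) (sym (ag 0 (s≤s z≤n))) α'∈X)

closed-∪ : ∀ {F G} → Closed3 F → Closed3 G →
  Closed3 (λ α β γ → F α β γ ⊎ G α β γ)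
closed-∪ {F} {G} cF cG α β γ ∉F∪G
  with cF α β γ (λ f → ∉F∪G (inj₁ f)) | cG α β γ (λ g → ∉F∪G (inj₂ g))
... | m , nbhdF | n , nbhdG = m ⊔ n , avoid
  where
    avoid : ∀ α' β' γ' → Agree (m ⊔ n) α α' → Agree (m ⊔ n) β β' →
      Agree (m ⊔ n) γ γ' → ¬ (F α' β' γ' ⊎ G α' β' γ')
    avoid α' β' γ' a b c (inj₁ f) =
      nbhdF α' β' γ' (agree-≤ (m≤m⊔n m n) a) (agree-≤ (m≤m⊔n m n) b)
        (agree-≤ (m≤m⊔n m n) c) f
    avoid α' β' γ' a b c (inj₂ g) =
      nbhdG α' β' γ' (agree-≤ (m≤n⊔m m n) a) (agree-≤ (m≤n⊔m m n) b)
        (agree-≤ (m≤n⊔m m n) c) g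

closed-swap : ∀ {F} → Closed3 F → Closed3 (λ α β γ → F β α γ)
closed-swap cF α β γ ∉F with cF β α γ ∉F
... | n , nbhd = n , λ α' β' γ' a b c → nbhd β' α' γ' b a c

closed-tail : ∀ {C} → Closed3 C → Closed3 (λ α β γ → C α β (tail γ))
closed-tail cC α β γ ∉C with cC α β (tail γ) ∉C
... | n , nbhd = suc n , λ α' β' γ' a b c →
  nbhd α' β' (tail γ') (agree-≤ (n≤1+n n) a) (agree-≤ (n≤1+n n) b) (agree-tail c)

X³ : Rel3
X³ α β γ = InX α × InX β × InX γ

-- Intersecting with the clopen set X³ preserves closedness; membership in X
-- is decidable, so we can tell which reason excludes a point.
closed-X³∩ : ∀ {F} → Closed3 F → Closed3 (λ α β γ → X³ α β γ × F α β γ)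
closed-X³∩ cF α β γ ∉X³∩F with 0 <? α 0 | 0 <? β 0 | 0 <? γ 0
... | no α∉X | _ | _ = 1 , λ α' β' γ' a b c ((α'∈X , _) , _) → notX-open α∉X a α'∈X
... | yes _ | no β∉X | _ = 1 , λ α' β' γ' a b c ((_ , β'∈X , _) , _) → notX-open β∉X b β'∈X
... | yes _ | yes _ | no γ∉X = 1 , λ α' β' γ' a b c ((_ , _ , γ'∈X) , _) → notX-open γ∉X c γ'∈X
... | yes α∈X | yes β∈X | yes γ∈X with cF α β γ (λ f → ∉X³∩F ((α∈X , β∈X , γ∈X) , f))
...   | n , nbhd = n , λ α' β' γ' a b c (_ , f) → nbhd α' β' γ' a b c f

symmetrise : Rel3 → Rel3
symmetrise C α β γ = X³ α β γ × (C α β (tail γ) ⊎ C β α (tail γ))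

symmetrise-closed : ∀ {C} → Closed3 C → Closed3 (symmetrise C)
symmetrise-closed cC = closed-X³∩ (closed-∪ (closed-tail cC) (closed-tail (closed-swap cC)))

symmetrise-τ : ∀ C α β γ → symmetrise C α β γ → symmetrise C β α γ
symmetrise-τ C α β γ ((α∈X , β∈X , γ∈X) , c) = (β∈X , α∈X , γ∈X) , swap c

into-X : Baire → Baire
into-X δ zero = 1
into-X δ (suc i) = δ i

symmetrise-projects : ∀ (E : Rel2) C → (∀ α β → E α β → E β α) →
  (∀ α β → (E α β ⇔ ∃ λ γ → C α β γ)) →
  ∀ α β → InX α → InX β → (E α β ⇔ ∃ λ γ → symmetrise C α β γ)
symmetrise-projects E C E-sym E⇔C α β α∈X β∈X = mk⇔ witness project
  where
    witness : E α β → ∃ λ γ → symmetrise C α β γ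
    witness e with Equivalence.to (E⇔C α β) e
    ... | δ , c = into-X δ , (α∈X , β∈X , s≤s z≤n) , inj₁ c

    project : (∃ λ γ → symmetrise C α β γ) → E α β
    project (γ , _ , inj₁ c) = Equivalence.from (E⇔C α β) (tail γ , c)
    project (γ , _ , inj₂ c) = E-sym β α (Equivalence.from (E⇔C β α) (tail γ , c))

SymmetricClosedProjection : Rel2 → Set₁
SymmetricClosedProjection E = Σ Rel3 λ F →
  Closed3 F ×
  (∀ α β γ → F α β γ → InX α × InX β × InX γ) ×
  (∀ α β γ → F α β γ → F β α γ) ×
  (∀ α β → InX α → InX β → (E α β ⇔ ∃ λ γ → F α β γ))

lemma1 : (E : Rel2) →
    (∀ α β → E α β → InX α × InX β) →
    (∀ α β → E α β → E β α) →
    (Analytic2 E ⇔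
    (Σ Rel3 λ F →
    Closed3 F ×
    (∀ α β γ → F α β γ → InX α × InX β × InX γ) ×
    (∀ α β γ → F α β γ → F β α γ) ×
    (∀ α β → InX α → InX β → (E α β ⇔ ∃ λ γ → F α β γ))))
lemma1 E E⊆X² E-sym = mk⇔ symmetric-witness analytic
  where
    symmetric-witness : Analytic2 E → SymmetricClosedProjection E
    symmetric-witness (C , cC , E⇔C) =
      symmetrise C , symmetrise-closed cC , (λ α β γ (inX³ , _) → inX³) ,
      symmetrise-τ C , symmetrise-projects E C E-sym E⇔C

    analytic : SymmetricClosedProjection E → Analytic2 E
    analytic (F , cF , F⊆X³ , _ , E⇔F) = F , cF , λ α β → mk⇔
      (λ e → let (α∈X , β∈X) = E⊆X² α β e in Equivalence.to (E⇔F α β α∈X β∈X) e)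
      (λ (γ , f) → let (α∈X , β∈X , _) = F⊆X³ α β γ f in
        Equivalence.from (E⇔F α β α∈X β∈X) (γ , f))
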